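{- Let $\mathcal{K}$ be a Fraïssé class whose Fraïssé symmetry $(\mathbb{D}_\mathcal{K},G_\mathcal{K})$ is well-behaved. Let $\mathfrak{A},\mathfrak{B}\in\mathcal{K}$, $S\le\mathrm{Aut}(\mathfrak{A})$, $T\le\mathrm{Aut}(\mathfrak{B})$, $X=[\![\mathfrak{A},S]\!]$ and $Y=[\![\mathfrak{B},T]\!]$. Then equivariant functions $X\to Y$ are in bijective correspondence with the $\equiv_T$-classes of those embeddings $u:\mathfrak{B}\to\mathfrak{A}$ such that for every $\sigma\in S$ there is $\tau\in T$ with $\sigma\circ u=u\circ\tau$; here $u\equiv_T v$ iff $v=u\circ\tau$ for some $\tau\in T$.
   Context: Fix a finite relational signature; embeddings are injective maps preserving and reflecting all relations. A Fraïssé class $\mathcal{K}$ is a class of finite structures closed under isomorphism and substructures with amalgamation (for embeddings $\mathfrak{A}\to\mathfrak{B}$, $\mathfrak{A}\to\mathfrak{C}$ in $\mathcal{K}$ there is $\mathfrak{D}\in\mathcal{K}$ with embeddings $\mathfrak{B}\to\mathfrak{D}$, $\mathfrak{C}\to\mathfrak{D}$ agreeing on $\mathfrak{A}$). Its Fraïssé limit $\mathfrak{U}_\mathcal{K}$ is the countable homogeneous structure whose finite substructures are, up to isomorphism, exactly $\mathcal{K}$; $\mathbb{D}_\mathcal{K}$ is its carrier, $G_\mathcal{K}=\mathrm{Aut}(\mathfrak{U}_\mathcal{K})$. Nominal: every element $x$ has a finite $C$ with $x\cdot\pi=x$ whenever $\pi$ fixes $C$ pointwise. Well-behaved: every element of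 every nominal $G_\mathcal{K}$-set has a least finite support, and every finite $C\subseteq\mathbb{D}_\mathcal{K}$ is fungible (for each $c\in C$ some $\pi\in G_\mathcal{K}$ moves $c$ and fixes $C\setminus\{c\}$ pointwise). For $\mathfrak{A}\in\mathcal{K}$, $S\le\mathrm{Aut}(\mathfrak{A})$: $[\![\mathfrak{A},S]\!]$ is the set of embeddings $u:\mathfrak{A}\to\mathfrak{U}_\mathcal{K}$ modulo $u\equiv_S v\iff v=u\circ\sigma$ for some $\sigma\in S$, with action $[u]\cdot\pi=[\pi\circ u]$. -}

module Defs where

open import Level using (0ℓ)
open import Data.Nat using (ℕ)
open import Data.Fin using (Fin)
open import Data.Vec using (Vec; map)
open import Data.Vec.Properties using (map-∘)
open import Data.List using (List)
open import Data.List.Membership.Propositional using (_∈_)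
open import Data.Product using (Σ; _×_; _,_; ∃; ∃-syntax; proj₁; proj₂)
open import Function using (_∘_; id; _⇔_)
open import Relation.Binary using (Setoid)
open import Relation.Binary.PropositionalEquality
  using (_≡_; _≢_; refl; sym; trans; cong; subst)

record Signature : Set where
  field
    nsym : ℕ
    ar   : Fin nsym → ℕ
open Signature public

record Structure (σ : Signature) (C : Set) : Set₁ where
  field
    rel : (r : Fin (nsym σ)) → Vec C (ar σ r) → Set
open Structure public

FinStructure : Signature → ℕ → Set₁
FinStructure σ n = Structure σ (Fin n)

record Emb {σ : Signature} {C₁ C₂ : Set}
           (M : Structure σ C₁) (N : Structure σ C₂) : Set where
  field
    fun  : C₁ → C₂
    inj  : ∀ x y → fun x ≡ fun y → x ≡ y
    pres : ∀ r (xs : Vec C₁ (ar σ r)) → rel M r xs → rel N r (map fun xs)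
    reflect : ∀ r (xs : Vec C₁ (ar σ r)) → rel N r (map fun xs) → rel M r xs
open Emb public

_∘ₑ_ : {σ : Signature} {C₁ C₂ C₃ : Set}
       {L : Structure σ C₁} {M : Structure σ C₂} {N : Structure σ C₃} →
       Emb M N → Emb L M → Emb L N
_∘ₑ_ {N = N} v u = record
  { fun  = fun v ∘ fun u
  ; inj  = λ x y e → inj u x y (inj v _ _ e)
  ; pres = λ r xs p → subst (rel N r) (sym (map-∘ (fun v) (fun u) xs))
                            (pres v r _ (pres u r xs p))
  ; reflect = λ r xs p → Emb.reflect u r xs
             (Emb.reflect v r _ (subst (rel N r) (map-∘ (fun v) (fun u) xs) p)) }

record Iso {σ : Signature} {C₁ C₂ : Set}
           (M : Structure σ C₁) (N : Structure σ C₂) : Set where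
  field
    emb   : Emb M N
    inv   : C₂ → C₁
    linv  : ∀ x → inv (fun emb x) ≡ x
    rinv  : ∀ y → fun emb (inv y) ≡ y

Aut : {σ : Signature} {C : Set} → Structure σ C → Set
Aut M = Iso M M

⟪_⟫ : {σ : Signature} {C : Set} {M : Structure σ C} → Aut M → C → C
⟪ π ⟫ = fun (Iso.emb π)

idAut : {σ : Signature} {C : Set} (M : Structure σ C) → Aut M
idAut {σ} {C} M = record
  { emb  = record { fun = id ; inj = λ _ _ e → e
                  ; pres = λ r xs p → subst (rel M r) (sym (mapid xs)) p
                  ; reflect = λ r xs p → subst (rel M r) (mapid xs) p }
  ; inv  = id ; linv = λ _ → refl ; rinv = λ _ → refl }
  where
  open import Data.Vec.Properties using (map-id)
  mapid : ∀ {k} (xs : Vec C k) → map id xs ≡ xs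
  mapid = map-id

-- diagrammatic composition: (π ⨾ ρ) applies π first, then ρ
_⨾_ : {σ : Signature} {C : Set} {M : Structure σ C} → Aut M → Aut M → Aut M
π ⨾ ρ = record
  { emb  = Iso.emb ρ ∘ₑ Iso.emb π
  ; inv  = Iso.inv π ∘ Iso.inv ρ
  ; linv = λ x → trans (cong (Iso.inv π) (Iso.linv ρ (⟪ π ⟫ x))) (Iso.linv π x)
  ; rinv = λ y → trans (cong ⟪ ρ ⟫ (Iso.rinv π (Iso.inv ρ y))) (Iso.rinv ρ y) }

_≗ᵃ_ : {σ : Signature} {C : Set} {M : Structure σ C} → Aut M → Aut M → Set
π ≗ᵃ ρ = ∀ x → ⟪ π ⟫ x ≡ ⟪ ρ ⟫ x

record Subgroup {σ : Signature} {C : Set} (M : Structure σ C) : Set₁ where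
  field
    mem      : Aut M → Set
    mem-resp : ∀ {π ρ} → π ≗ᵃ ρ → mem π → mem ρ
    mem-id   : mem (idAut M)
    mem-⨾    : ∀ {π ρ} → mem π → mem ρ → mem (π ⨾ ρ)
    mem-inv  : ∀ {π} → mem π → ∃[ ρ ] (mem ρ × (∀ x → ⟪ ρ ⟫ (⟪ π ⟫ x) ≡ x)
                                             × (∀ x → ⟪ π ⟫ (⟪ ρ ⟫ x) ≡ x))
open Subgroup public

FClass : Signature → Set₂
FClass σ = ∀ {n} → FinStructure σ n → Set₁

record IsFraisseClass {σ : Signature} (K : FClass σ) : Set₁ where
  field
    iso-closed : ∀ {m n} {A : FinStructure σ m} {B : FinStructure σ n} →
                 Iso A B → K A → K B
    sub-closed : ∀ {m n} {A : FinStructure σ m} {B : FinStructure σ n} →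
                 Emb A B → K B → K A
    amalgamation :
      ∀ {l m n} {A : FinStructure σ l} {B : FinStructure σ m}
        {C : FinStructure σ n} → K A → K B → K C →
      (f : Emb A B) (g : Emb A C) →
      ∃[ k ] Σ (FinStructure σ k) λ D → K D × Σ (Emb B D) λ f' → Σ (Emb C D) λ g' →
        (∀ a → fun f' (fun f a) ≡ fun g' (fun g a))

-- U (carrier D) is the Fraïssé limit of K: countable, homogeneous, and its
-- finite substructures are, up to isomorphism, exactly the members of K.
-- (Finite substructures of U up to isomorphism = finite structures
-- embeddable in U.)
record IsFraisseLimit {σ : Signature} (K : FClass σ) {D : Set}
                      (U : Structure σ D) : Set₁ where
  field
    countable   : Σ (D → ℕ) λ e → ∀ x y → e x ≡ e y → x ≡ y
    homogeneous : ∀ {n} {A : FinStructure σ n} (u v : Emb A U) →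
                  Σ (Aut U) λ π → (∀ a → ⟪ π ⟫ (fun u a) ≡ fun v a)
    age         : ∀ {n} (A : FinStructure σ n) → (K A → Emb A U) × (Emb A U → K A)

module _ {σ : Signature} {D : Set} (U : Structure σ D) where

  record GSet : Set₁ where
    field
      setoid   : Setoid 0ℓ 0ℓ
    open Setoid setoid public
    field
      act      : Carrier → Aut U → Carrier
      act-cong : ∀ {x y π ρ} → x ≈ y → π ≗ᵃ ρ → act x π ≈ act y ρ
      act-id   : ∀ x → act x (idAut U) ≈ x
      act-⨾    : ∀ x π ρ → act x (π ⨾ ρ) ≈ act (act x π) ρ

  -- C (a finite subset of D, as a list) supports x
  Supports : (X : GSet) → List D → GSet.Carrier X → Set
  Supports X C x = ∀ (π : Aut U) → (∀ c → c ∈ C → ⟪ π ⟫ c ≡ c) →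
                   GSet._≈_ X (GSet.act X x π) x

  _⊆ₗ_ : List D → List D → Set
  C ⊆ₗ C' = ∀ c → c ∈ C → c ∈ C'

  IsNominal : GSet → Set
  IsNominal X = ∀ x → ∃[ C ] Supports X C x

  HasLeastSupport : (X : GSet) → GSet.Carrier X → Set
  HasLeastSupport X x =
    ∃[ C ] (Supports X C x × (∀ C' → Supports X C' x → C ⊆ₗ C'))

  Fungible : List D → Set
  Fungible C = ∀ c → c ∈ C →
    Σ (Aut U) λ π → (⟪ π ⟫ c ≢ c × (∀ d → d ∈ C → d ≢ c → ⟪ π ⟫ d ≡ d))

  record WellBehaved : Set₁ where
    field
      least-supports : ∀ (X : GSet) → IsNominal X → ∀ x → HasLeastSupport X x
      fungible       : ∀ (C : List D) → Fungible C

module _ {σ : Signature} {D : Set} (U : Structure σ D) where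

  _·_ : ∀ {n} {A : FinStructure σ n} → Emb A U → Aut U → Emb A U
  u · π = Iso.emb π ∘ₑ u

  Equiv : ∀ {n} {A : FinStructure σ n} {C : Set} {N : Structure σ C} →
          Subgroup A → Emb A N → Emb A N → Set
  Equiv S u v = ∃[ s ] (mem S s × (∀ a → fun v a ≡ fun u (⟪ s ⟫ a)))

  -- Equivariant functions [[A,S]] → [[B,T]], presented on representatives:
  -- a map on embeddings A → U respecting ≡_S (into ≡_T) and commuting
  -- with the action up to ≡_T.
  record EqFun {m n} {A : FinStructure σ m} {B : FinStructure σ n}
               (S : Subgroup A) (T : Subgroup B) : Set where
    field
      F       : Emb A U → Emb B U
      F-cong  : ∀ u v → Equiv S u v → Equiv T (F u) (F v)
      F-equiv : ∀ u π → Equiv T (F (u · π)) (F u · π)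
  open EqFun public

  _≈ᶠ_ : ∀ {m n} {A : FinStructure σ m} {B : FinStructure σ n}
           {S : Subgroup A} {T : Subgroup B} → EqFun S T → EqFun S T → Set
  _≈ᶠ_ {T = T} f g = ∀ u → Equiv T (F f u) (F g u)

record Compatible {σ : Signature} {m n} {A : FinStructure σ m}
                  {B : FinStructure σ n} (S : Subgroup A) (T : Subgroup B)
                  : Set₁ where
  field
    emb    : Emb B A
    compat : ∀ s → mem S s →
             ∃[ t ] (mem T t × (∀ b → ⟪ s ⟫ (fun emb b) ≡ fun emb (⟪ t ⟫ b)))
open Compatible public

-- Restriction along a compatible u : B → A, v ↦ v ∘ u, is equivariant, and it
-- is injective on ≡_T-classes because any single embedding w₀ : A → U can be
-- cancelled. For surjectivity, an equivariant f is determined by g = f(w₀),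
-- since by homogeneity every embedding A → U is w₀ · π. The class of g is
-- fixed by every π fixing the image of w₀ pointwise; fungibility then forces
-- the image of g into the image of w₀. So g = w₀ ∘ u, and equivariance of f
-- makes u compatible with S and T.
module Submission where

open import Defs
import Data.Nat as ℕ
open import Data.Product using (Σ; _×_; _,_; ∃; ∃-syntax; proj₁; proj₂)
open import Data.Fin.Properties using (any?)
open import Data.Vec using (Vec; map)
open import Data.Vec.Properties using (map-∘; map-cong)
open import Data.List using (_++_; tabulate)
open import Data.List.Membership.Propositional.Properties
  using (∈-++⁺ˡ; ∈-++⁺ʳ; ∈-tabulate⁺)
open import Data.Empty using (⊥-elim)
open import Function using (_∘_)
open import Relation.Binary.Definitions using (DecidableEquality)
open import Relation.Binary.PropositionalEquality
open import Relation.Nullary using (yes; no)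
open import Relation.Nullary.Decidable using (map′)

module _ {σ : Signature} {D : Set} (U : Structure σ D)
         {n} {B : FinStructure σ n} (T : Subgroup B) where

  module _ {C : Set} {N : Structure σ C} where

    Equiv-reflexive : (u v : Emb B N) → (∀ b → fun u b ≡ fun v b) → Equiv U T u v
    Equiv-reflexive _ _ u≗v = idAut B , mem-id T , λ b → sym (u≗v b)

    Equiv-sym : (u v : Emb B N) → Equiv U T u v → Equiv U T v u
    Equiv-sym u v (t , t∈T , v≗ut) with mem-inv T t∈T
    ... | t⁻¹ , t⁻¹∈T , _ , tt⁻¹≗id = t⁻¹ , t⁻¹∈T , λ b → begin
      fun u b               ≡⟨ cong (fun u) (sym (tt⁻¹≗id b)) ⟩
      fun u (⟪ t ⟫ (⟪ t⁻¹ ⟫ b)) ≡⟨ sym (v≗ut (⟪ t⁻¹ ⟫ b)) ⟩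
      fun v (⟪ t⁻¹ ⟫ b)      ∎
      where open ≡-Reasoning

    Equiv-trans : (u v w : Emb B N) → Equiv U T u v → Equiv U T v w → Equiv U T u w
    Equiv-trans u _ _ (t , t∈T , v≗ut) (t′ , t′∈T , w≗vt′) =
      t′ ⨾ t , mem-⨾ T t′∈T t∈T , λ b → trans (w≗vt′ b) (v≗ut (⟪ t′ ⟫ b))

  module _ {C₁ C₂ : Set} {M : Structure σ C₁} {N : Structure σ C₂} where

    Equiv-postcompose : (w : Emb M N) (u v : Emb B M) →
                        Equiv U T u v → Equiv U T (w ∘ₑ u) (w ∘ₑ v)
    Equiv-postcompose w _ _ (t , t∈T , v≗ut) = t , t∈T , λ b → cong (fun w) (v≗ut b)

    Equiv-cancelˡ : (w : Emb M N) (u v : Emb B M) →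
                    Equiv U T (w ∘ₑ u) (w ∘ₑ v) → Equiv U T u v
    Equiv-cancelˡ w _ _ (t , t∈T , wv≗wut) = t , t∈T , λ b → inj w _ _ (wv≗wut b)

factor-through : {σ : Signature} {C₁ C₂ C₃ : Set}
                 {M : Structure σ C₁} {L : Structure σ C₂} {N : Structure σ C₃}
                 (w : Emb M N) (g : Emb L N) (u : C₂ → C₁) →
                 (∀ x → fun w (u x) ≡ fun g x) → Emb L M
factor-through {σ} {N = N} w g u wu≗g = record
  { fun     = u
  ; inj     = λ x y ux≡uy →
      inj g x y (trans (sym (wu≗g x)) (trans (cong (fun w) ux≡uy) (wu≗g y)))
  ; pres    = λ r xs p →
      Emb.reflect w r (map u xs) (subst (rel N r) (g≡wu xs) (pres g r xs p))
  ; reflect = λ r xs p →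
      Emb.reflect g r xs (subst (rel N r) (sym (g≡wu xs)) (pres w r (map u xs) p)) }
  where
  g≡wu : ∀ {k} (xs : Vec _ k) → map (fun g) xs ≡ map (fun w) (map u xs)
  g≡wu xs = trans (map-cong (λ x → sym (wu≗g x)) xs) (map-∘ (fun w) u xs)

module _ {σ : Signature} {D : Set} (U : Structure σ D) where

  FixesImage : ∀ {m} {A : FinStructure σ m} → Aut U → Emb A U → Set
  FixesImage π w = ∀ a → ⟪ π ⟫ (fun w a) ≡ fun w a

  image⊆image-of-support :
    DecidableEquality D → (∀ C → Fungible U C) →
    ∀ {m n} {A : FinStructure σ m} {B : FinStructure σ n} (T : Subgroup B)
    (w : Emb A U) (g : Emb B U) →
    (∀ π → FixesImage π w → Equiv U T g (_·_ U g π)) →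
    ∀ b → ∃[ a ] fun w a ≡ fun g b
  image⊆image-of-support _≟_ fungible T w g stable b
    with any? (λ a → fun w a ≟ fun g b)
  ... | yes found = found
  ... | no ¬found = ⊥-elim (moves-d d-is-fixed)
    where
    d = fun g b
    moved = fungible (tabulate (fun w) ++ tabulate (fun g)) d
                     (∈-++⁺ʳ (tabulate (fun w)) (∈-tabulate⁺ b))
    π            = proj₁ moved
    moves-d      = proj₁ (proj₂ moved)
    fixes-others = proj₂ (proj₂ moved)
    πd≡gtb : ∃[ t ] (⟪ π ⟫ d ≡ fun g (⟪ t ⟫ b))
    πd≡gtb with stable π (λ a → fixes-others (fun w a) (∈-++⁺ˡ (∈-tabulate⁺ a))
                                             (λ wa≡d → ¬found (a , wa≡d)))
    ... | t , _ , eq = t , eq b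
    -- π d lies in the image of g, so it is fixed unless it equals d; since π
    -- is injective, either way π d ≡ d.
    d-is-fixed : ⟪ π ⟫ d ≡ d
    d-is-fixed with πd≡gtb
    ... | t , πd≡y with fun g (⟪ t ⟫ b) ≟ d
    ...   | yes y≡d = trans πd≡y y≡d
    ...   | no  y≢d = ⊥-elim (y≢d (inj (Iso.emb π) _ _ (trans
              (fixes-others _ (∈-++⁺ʳ (tabulate (fun w)) (∈-tabulate⁺ (⟪ t ⟫ b))) y≢d)
              (sym πd≡y))))

module _ {σ : Signature} {D : Set} (U : Structure σ D)
         {m n} {A : FinStructure σ m} {B : FinStructure σ n}
         (S : Subgroup A) (T : Subgroup B) where

  restrict : Compatible S T → EqFun U S T
  restrict c = record
    { F       = _∘ₑ emb c
    ; F-cong  = precompose-compatible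
    ; F-equiv = λ v π →
        Equiv-reflexive U T (_·_ U v π ∘ₑ emb c) (_·_ U (v ∘ₑ emb c) π) (λ _ → refl) }
    where
    precompose-compatible : ∀ v v′ → Equiv U S v v′ →
                            Equiv U T (v ∘ₑ emb c) (v′ ∘ₑ emb c)
    precompose-compatible v v′ (s , s∈S , v′≗vs) with compat c s s∈S
    ... | t , t∈T , su≗ut =
      t , t∈T , λ b → trans (v′≗vs (fun (emb c) b)) (cong (fun v) (su≗ut b))

  restrict-resp : ∀ u v → Equiv U T (emb u) (emb v) → _≈ᶠ_ U (restrict u) (restrict v)
  restrict-resp u v u~v w = Equiv-postcompose U T w (emb u) (emb v) u~v

  restrict-injective : Emb A U →
    ∀ u v → _≈ᶠ_ U (restrict u) (restrict v) → Equiv U T (emb u) (emb v)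
  restrict-injective w₀ u v Φu≈Φv = Equiv-cancelˡ U T w₀ (emb u) (emb v) (Φu≈Φv w₀)

  F-translate : (f : EqFun U S T) (w : Emb A U) (π : Aut U) →
                Equiv U S w (_·_ U w π) → Equiv U T (F f w) (_·_ U (F f w) π)
  F-translate f w π w~wπ =
    Equiv-trans U T (F f w) (F f (_·_ U w π)) (_·_ U (F f w) π)
      (F-cong f w (_·_ U w π) w~wπ) (F-equiv f w π)

  module _ (_≟_ : DecidableEquality D) (fungible : ∀ C → Fungible U C)
           (homogeneous : ∀ {k} {E : FinStructure σ k} (u v : Emb E U) →
                          Σ (Aut U) λ π → (∀ e → ⟪ π ⟫ (fun u e) ≡ fun v e))
           (w₀ : Emb A U) (f : EqFun U S T) where

    private
      g : Emb B U
      g = F f w₀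

      g-in-image : ∀ b → ∃[ a ] fun w₀ a ≡ fun g b
      g-in-image = image⊆image-of-support U _≟_ fungible T w₀ g λ π π-fixes →
        F-translate f w₀ π (Equiv-reflexive U S w₀ (_·_ U w₀ π) (λ a → sym (π-fixes a)))

    factor : Emb B A
    factor = factor-through w₀ g (proj₁ ∘ g-in-image) (proj₂ ∘ g-in-image)

    factor-compatible : ∀ s → mem S s →
      ∃[ t ] (mem T t × (∀ b → ⟪ s ⟫ (fun factor b) ≡ fun factor (⟪ t ⟫ b)))
    factor-compatible s s∈S with homogeneous w₀ (w₀ ∘ₑ Iso.emb s)
    ... | π , πw₀≗w₀s with F-translate f w₀ π (s , s∈S , λ a → πw₀≗w₀s a)
    ...   | t , t∈T , πg≗gt = t , t∈T , λ b → inj w₀ _ _ (begin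
      fun w₀ (⟪ s ⟫ (fun factor b))    ≡⟨ sym (πw₀≗w₀s (fun factor b)) ⟩
      ⟪ π ⟫ (fun w₀ (fun factor b))    ≡⟨ cong ⟪ π ⟫ (proj₂ (g-in-image b)) ⟩
      ⟪ π ⟫ (fun g b)                 ≡⟨ πg≗gt b ⟩
      fun g (⟪ t ⟫ b)                 ≡⟨ sym (proj₂ (g-in-image (⟪ t ⟫ b))) ⟩
      fun w₀ (fun factor (⟪ t ⟫ b))    ∎)
      where open ≡-Reasoning

    factorᶜ : Compatible S T
    factorᶜ = record { emb = factor ; compat = factor-compatible }

    restrict-factor : _≈ᶠ_ U (restrict factorᶜ) f
    restrict-factor v with homogeneous w₀ v
    ... | π , πw₀≗v = Equiv-sym U T (F f v) (v ∘ₑ factor)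
      (Equiv-trans U T (F f v) (F f w₀π) (v ∘ₑ factor)
        (F-cong f v w₀π (Equiv-reflexive U S v w₀π (λ a → sym (πw₀≗v a))))
        (Equiv-trans U T (F f w₀π) (_·_ U g π) (v ∘ₑ factor)
          (F-equiv f w₀ π)
          (Equiv-reflexive U T (_·_ U g π) (v ∘ₑ factor) λ b →
            trans (cong ⟪ π ⟫ (sym (proj₂ (g-in-image b)))) (πw₀≗v (fun factor b)))))
      where
      w₀π = _·_ U w₀ π

proposition10p8 :
    (σ : Signature) (K : FClass σ) → IsFraisseClass K →
    (D : Set) (U : Structure σ D) → IsFraisseLimit K U → WellBehaved U →
    ∀ {m n} (A : FinStructure σ m) (B : FinStructure σ n) → K A → K B →
    (S : Subgroup A) (T : Subgroup B) →
    Σ (Compatible S T → EqFun U S T) λ Φ →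
      (∀ u v → Equiv U T (emb u) (emb v) → _≈ᶠ_ U (Φ u) (Φ v))
      × (∀ u v → _≈ᶠ_ U (Φ u) (Φ v) → Equiv U T (emb u) (emb v))
      × (∀ (f : EqFun U S T) → ∃[ u ] _≈ᶠ_ U (Φ u) f)
proposition10p8 σ K _ D U limit wellBehaved A _ kA _ S T =
    restrict U S T
  , restrict-resp U S T
  , restrict-injective U S T w₀
  , λ f → factorᶜ U S T _≟_ fungible homogeneous w₀ f
        , restrict-factor U S T _≟_ fungible homogeneous w₀ f
  where
  open IsFraisseLimit limit using (countable; homogeneous; age)
  open WellBehaved wellBehaved using (fungible)

  w₀ : Emb A U
  w₀ = proj₁ (age A) kA

  _≟_ : DecidableEquality D
  x ≟ y = map′ (proj₂ countable x y) (cong (proj₁ countable))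
               (proj₁ countable x ℕ.≟ proj₁ countable y)
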